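{- Let $G=(Y\cup Z,E)$ be a bipartite graph in which every vertex of $Y$ has valency $k$ and every vertex of $Z$ has valency $\ell$. Suppose that every vertex $y\in Y$ is locally distance-regular with parameters \[ \begin{vmatrix} k; & 1, & c_2^{Y}, & c_3^{Y}, & k\end{vmatrix}, \] i.e. $y$ has eccentricity $4$ and for each $i\in\{1,2,3,4\}$ and each vertex $w$ at distance $i$ from $y$, the number of neighbours of $w$ at distance $i-1$ from $y$ equals $1,c_2^Y,c_3^Y,k$ for $i=1,2,3,4$ respectively. Suppose further that there is a constant $c_2^{Z}$ such that for every $z\in Z$ and every vertex $w$ at distance two from $z$, the number of common neighbours of $z$ and $w$ equals $c_2^Z$, and that $k>\frac{c_2^{Y}c_3^{Y}}{c_2^{Z}}$. Then $G$ is distance-biregular with intersection array \[ \begin{vmatrix} k; & 1, & c_2^{Y}, & c_3^{Y}, & k \\ \ell; & 1, & c_2^{Z}, & \frac{c_2^{Y}c_3^{Y}}{c_2^{Z}}, & \ell\end{vmatrix}. \]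
   Context: For a vertex $a$ of a graph, $N_i(a)$ denotes the set of vertices at distance $i$ from $a$. A bipartite graph with bipartition $Y\cup Z$ is distance-biregular if for every vertex $a$, every $i$, and every vertex $w$ at distance $i$ from $a$, the numbers $c_i(a)=|\{u\sim w: d(a,u)=i-1\}|$ and $b_i(a)=|\{u\sim w: d(a,u)=i+1\}|$ depend only on $i$ and on which part ($Y$ or $Z$) contains $a$; these common values are denoted $c_i^Y,b_i^Y$ (for $a\in Y$) and $c_i^Z,b_i^Z$ (for $a\in Z$). The intersection array $\begin{vmatrix} k; & c_1^{Y}, & \dots, & c_{d_Y}^{Y} \\ \ell; & c_1^{Z}, & \dots, & c_{d_Z}^{Z}\end{vmatrix}$ records the valency $k$ of vertices in $Y$, the valency $\ell$ of vertices in $Z$, and the numbers $c_i$ for $1\le i\le d_Y$ (resp. $d_Z$), where $d_Y$ (resp. $d_Z$) is the eccentricity of vertices of $Y$ (resp. $Z$). -}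

module Defs where

open import Data.Nat using (ℕ; zero; suc; _<_; _≤_)
open import Data.Fin using (Fin)
open import Data.Bool using (Bool; true; false; T)
open import Data.List using (List; length)
open import Data.List.Membership.Propositional using (_∈_)
open import Data.List.Relation.Unary.Unique.Propositional using (Unique)
open import Data.Product using (Σ; _×_; ∃-syntax)
open import Relation.Nullary using (¬_)
open import Relation.Binary.PropositionalEquality using (_≡_; _≢_)

record BipartiteGraph : Set where
  field
    n     : ℕ
    adj   : Fin n → Fin n → Bool
    sym   : ∀ u v → adj u v ≡ adj v u
    irrefl : ∀ u → adj u u ≡ false
    inY   : Fin n → Bool
    bip   : ∀ u v → T (adj u v) → inY u ≢ inY v

module _ (G : BipartiteGraph) where
  open BipartiteGraph G

  V : Set
  V = Fin n

  Adj : V → V → Set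
  Adj u v = T (adj u v)

  InY InZ : V → Set
  InY u = inY u ≡ true
  InZ u = inY u ≡ false

  HasCount : (V → Set) → ℕ → Set
  HasCount P c = Σ (List V) λ xs → Unique xs × (∀ u → (u ∈ xs → P u) × (P u → u ∈ xs)) × length xs ≡ c

  data Walk : V → V → ℕ → Set where
    here : ∀ {a} → Walk a a zero
    step : ∀ {a b c m} → Adj a b → Walk b c m → Walk a c (suc m)

  Dist : V → V → ℕ → Set
  Dist a b i = Walk a b i × (∀ j → j < i → ¬ Walk a b j)

  Ecc : V → ℕ → Set
  Ecc a e = (∀ w → Σ ℕ λ i → i ≤ e × Dist a w i) × (Σ V λ w → Dist a w e)

  -- c_i(a) at w equals c : #{u ~ w : d(a,u) = i-1} = c   (for i = 0 this set is empty)
  CAt : V → V → ℕ → ℕ → Set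
  CAt a w i c = HasCount (λ u → Adj w u × Σ ℕ λ j → suc j ≡ i × Dist a u j) c

  BAt : V → V → ℕ → ℕ → Set
  BAt a w i b = HasCount (λ u → Adj w u × Dist a u (suc i)) b

  Valency : V → ℕ → Set
  Valency a d = HasCount (Adj a) d

  LocallyDR4 : V → ℕ → ℕ → ℕ → Set
  LocallyDR4 y k c2 c3 =
    Ecc y 4 ×
    (∀ w → (Dist y w 1 → CAt y w 1 1) × (Dist y w 2 → CAt y w 2 c2) ×
           (Dist y w 3 → CAt y w 3 c3) × (Dist y w 4 → CAt y w 4 k))

  IsDBRWith : (cY bY cZ bZ : ℕ → ℕ) → Set
  IsDBRWith cY bY cZ bZ =
    (∀ a w i → InY a → Dist a w i → CAt a w i (cY i) × BAt a w i (bY i)) ×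
    (∀ a w i → InZ a → Dist a w i → CAt a w i (cZ i) × BAt a w i (bZ i))

  -- distance-biregular with intersection array
  --   | k; 1, c2Y, c3Y, k |
  --   | l; 1, c2Z, c3Z, l |   (both eccentricities 4)
  -- where c3Z is specified by  c3Z * c2Z = c2Y * c3Y  (i.e. c3Z = c2Y c3Y / c2Z, c2Z > 0)
  DBRArray4 : (k l c2Y c3Y c2Z : ℕ) → Set
  DBRArray4 k l c2Y c3Y c2Z =
    Σ (ℕ → ℕ) λ cY → Σ (ℕ → ℕ) λ bY → Σ (ℕ → ℕ) λ cZ → Σ (ℕ → ℕ) λ bZ →
      IsDBRWith cY bY cZ bZ ×
      (∀ y → InY y → Valency y k × Ecc y 4) ×
      (∀ z → InZ z → Valency z l × Ecc z 4) ×
      cY 1 ≡ 1 × cY 2 ≡ c2Y × cY 3 ≡ c3Y × cY 4 ≡ k ×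
      cZ 1 ≡ 1 × cZ 2 ≡ c2Z × cZ 3 * c2Z ≡ c2Y * c3Y × cZ 4 ≡ l
    where open import Data.Nat using (_*_)

{-# OPTIONS --safe #-}

-- The vertices of Y satisfy the required local conditions by hypothesis, and for z ∈ Z one has
-- c₁ = 1 and c₂ = c2Z. The crux is c₃ on Z. For w at distance 3 from z, count the paths
-- z ~ u ~ x ~ w from both ends: a neighbour x of w contributes its common neighbours with z,
-- of which there are c2Z if d(z,x) = 2 and none if d(z,x) = 4, and symmetrically for a neighbour
-- u of z. Hence c2Z · c₃(z,w) = c2Y · c₃(w,z) = c2Y · c3Y, so c₃ is constant on Z and equals
-- c2Y c3Y / c2Z < k; this leaves a neighbour of w at distance 4 from z. With the eccentricity of
-- the vertices of Y, z has eccentricity 4, hence c₄ = ℓ. Finally b_i = valency − c_i, because in a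
-- bipartite graph the neighbours of a vertex at distance i lie at distance i ± 1.

module Submission where

open import Defs
open import Data.Bool using (Bool; true; false; not; T)
open import Data.Bool.Properties using (T?; ¬-not)
open import Data.Nat using (ℕ; zero; suc; _+_; _*_; _∸_; _≤_; _<_; s≤s; NonZero; ≢-nonZero; >-nonZero⁻¹)
open import Data.Nat.Properties
  using (+-*-semiring; *-commutativeSemigroup; *-comm; *-identityˡ; *-identityʳ; *-zeroʳ; *-cancelˡ-≡; *-cancelʳ-<;
         ≤-refl; ≤-trans; <⇒≤; ≤-antisym; <-cmp; ≮⇒≥; ≤∧≢⇒<; 1+n≰n; m≢1+n+m; m+n∸m≡n; m<n⇒0<n∸m;
         m<n⇒n≢0; m*n≢0⇒m≢0; m*n≢0⇒n≢0; anyUpTo?)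
open import Data.Nat.Induction using (<-rec)
open import Data.Fin using (Fin; punchIn)
open import Data.Fin.Properties using (punchInᵢ≢i; any?) renaming (_≟_ to _≟ᶠ_)
open import Data.List using (List; []; _∷_; length; filter; allFin)
open import Data.List.Membership.Propositional using (_∈_)
open import Data.List.Membership.Propositional.Properties using (∈-filter⁺; ∈-filter⁻; ∈-allFin)
open import Data.List.Relation.Unary.Any using (here; there)
open import Data.List.Relation.Unary.All as All using ([])
open import Data.List.Relation.Unary.AllPairs using ([]; _∷_)
open import Data.List.Relation.Unary.Unique.Propositional using (Unique)
open import Data.List.Relation.Unary.Unique.Propositional.Properties using (filter⁺; allFin⁺)
open import Data.Product using (Σ; _×_; _,_; proj₁; proj₂)
open import Data.Sum using (_⊎_; inj₁; inj₂; [_,_])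
open import Function using (_∘_)
open import Relation.Nullary using (¬_; Dec; yes; no; contradiction)
open import Relation.Nullary.Decidable using (_×-dec_; _⊎-dec_; ¬?; map′)
open import Relation.Unary using (Decidable)
open import Relation.Binary using (tri<; tri≈; tri>)
open import Relation.Binary.PropositionalEquality using (_≡_; _≢_; refl; sym; trans; cong; cong₂; subst; module ≡-Reasoning)
open import Algebra.Properties.CommutativeSemigroup *-commutativeSemigroup using (x∙yz≈y∙xz)
open import Algebra.Properties.Semiring.Sum +-*-semiring
  using (sum-syntax; sum-cong-≗; sum-replicate-zero; sum-remove; ∑-distrib-+; ∑-comm; *-distribˡ-sum)

indicator : ∀ {a} {A : Set a} → Dec A → ℕ
indicator (yes _) = 1
indicator (no _)  = 0

private variable
  A B : Set

indicator-yes : A → (a? : Dec A) → indicator a? ≡ 1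
indicator-yes a (yes _) = refl
indicator-yes a (no ¬a) = contradiction a ¬a

indicator-no : ¬ A → (a? : Dec A) → indicator a? ≡ 0
indicator-no ¬a (yes a) = contradiction a ¬a
indicator-no ¬a (no _)  = refl

indicator-cong : (A → B) → (B → A) → (a? : Dec A) (b? : Dec B) → indicator a? ≡ indicator b?
indicator-cong f g (yes a) b? = sym (indicator-yes (f a) b?)
indicator-cong f g (no ¬a) b? = sym (indicator-no (¬a ∘ g) b?)

indicator-× : (a? : Dec A) (b? : Dec B) → indicator (a? ×-dec b?) ≡ indicator a? * indicator b?
indicator-× (yes _) (yes _) = refl
indicator-× (yes _) (no _)  = refl
indicator-× (no _)  _       = refl

indicator-⊎ : ¬ (A × B) → (a? : Dec A) (b? : Dec B) → indicator (a? ⊎-dec b?) ≡ indicator a? + indicator b?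
indicator-⊎ ¬ab (yes a) (yes b) = contradiction (a , b) ¬ab
indicator-⊎ ¬ab (yes _) (no _)  = refl
indicator-⊎ ¬ab (no _)  (yes _) = refl
indicator-⊎ ¬ab (no _)  (no _)  = refl

module _ {m : ℕ} where

  count : {P : Fin m → Set} → Decidable P → ℕ
  count P? = ∑[ v < m ] indicator (P? v)

  HasCountFin : (Fin m → Set) → ℕ → Set
  HasCountFin P c = Σ (List (Fin m)) λ xs → Unique xs × (∀ u → (u ∈ xs → P u) × (P u → u ∈ xs)) × length xs ≡ c

  module _ {P Q : Fin m → Set} (P? : Decidable P) (Q? : Decidable Q) where

    count-cong : (∀ v → P v → Q v) → (∀ v → Q v → P v) → count P? ≡ count Q?
    count-cong f g = sum-cong-≗ λ v → indicator-cong (f v) (g v) (P? v) (Q? v)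

    count-⊎ : (∀ v → ¬ (P v × Q v)) → count (λ v → P? v ⊎-dec Q? v) ≡ count P? + count Q?
    count-⊎ disjoint = trans (sum-cong-≗ λ v → indicator-⊎ (disjoint v) (P? v) (Q? v))
                             (∑-distrib-+ (indicator ∘ P?) (indicator ∘ Q?))

  count-∅ : {P : Fin m → Set} (P? : Decidable P) → (∀ v → ¬ P v) → count P? ≡ 0
  count-∅ P? ∅ = trans (sum-cong-≗ λ v → indicator-no (∅ v) (P? v)) (sum-replicate-zero m)

count-≟ : ∀ {m} (x : Fin m) → count (_≟ᶠ x) ≡ 1
count-≟ {suc m} x = begin
  count (_≟ᶠ x)                                       ≡⟨ sum-remove {i = x} (λ v → indicator (v ≟ᶠ x)) ⟩
  indicator (x ≟ᶠ x) + count (λ v → punchIn x v ≟ᶠ x)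
    ≡⟨ cong₂ _+_ (indicator-yes refl (x ≟ᶠ x)) (count-∅ _ (punchInᵢ≢i x)) ⟩
  1                                                    ∎
  where open ≡-Reasoning

module _ {m : ℕ} where
  open import Data.List.Membership.DecPropositional (_≟ᶠ_ {m}) using (_∈?_)

  length-count : (xs : List (Fin m)) → Unique xs → length xs ≡ count (_∈? xs)
  length-count []       _          = sym (count-∅ (_∈? []) λ v ())
  length-count (x ∷ xs) (x∉ ∷ uxs) = sym (begin
    count (_∈? (x ∷ xs))
      ≡⟨ count-cong (_∈? (x ∷ xs)) (λ v → (v ≟ᶠ x) ⊎-dec (v ∈? xs)) (λ _ → split) (λ _ → join) ⟩
    count (λ v → (v ≟ᶠ x) ⊎-dec (v ∈? xs))
      ≡⟨ count-⊎ (_≟ᶠ x) (_∈? xs) (λ { v (refl , v∈) → All.lookup x∉ v∈ refl }) ⟩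
    count (_≟ᶠ x) + count (_∈? xs)              ≡⟨ cong₂ _+_ (count-≟ x) (sym (length-count xs uxs)) ⟩
    suc (length xs)                             ∎)
    where
    open ≡-Reasoning
    split : ∀ {v} → v ∈ x ∷ xs → v ≡ x ⊎ v ∈ xs
    split (here v≡x) = inj₁ v≡x
    split (there v∈) = inj₂ v∈
    join : ∀ {v} → v ≡ x ⊎ v ∈ xs → v ∈ x ∷ xs
    join (inj₁ v≡x) = here v≡x
    join (inj₂ v∈)  = there v∈

  module _ {P : Fin m → Set} (P? : Decidable P) where

    hasCount⇒count : ∀ {c} → HasCountFin P c → count P? ≡ c
    hasCount⇒count (xs , uxs , mem , refl) =
      trans (count-cong P? (_∈? xs) (λ v → proj₂ (mem v)) (λ v → proj₁ (mem v))) (sym (length-count xs uxs))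

    count⇒hasCount : HasCountFin P (count P?)
    count⇒hasCount =
      xs , uxs , mem , trans (length-count xs uxs) (count-cong (_∈? xs) P? (λ v → proj₁ (mem v)) (λ v → proj₂ (mem v)))
      where
      xs : List (Fin m)
      xs = filter P? (allFin m)
      uxs : Unique xs
      uxs = filter⁺ P? (allFin⁺ m)
      mem : ∀ v → (v ∈ xs → P v) × (P v → v ∈ xs)
      mem v = proj₂ ∘ ∈-filter⁻ P? {xs = allFin m} , ∈-filter⁺ P? (∈-allFin v)

  hasCount-cong : {P Q : Fin m → Set} → (∀ v → P v → Q v) → (∀ v → Q v → P v) →
                  ∀ {c} → HasCountFin P c → HasCountFin Q c
  hasCount-cong f g (xs , uxs , mem , len) = xs , uxs , (λ v → f v ∘ proj₁ (mem v) , proj₂ (mem v) ∘ g v) , len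

  hasCount-nonempty : {P : Fin m → Set} → ∀ {c} → HasCountFin P c → 0 < c → Σ (Fin m) P
  hasCount-nonempty ([]     , _ , _   , refl) ()
  hasCount-nonempty (x ∷ _  , _ , mem , _)    _ = x , proj₁ (mem x) (here refl)

sideAfter : ℕ → Bool → Bool
sideAfter zero    s = s
sideAfter (suc i) s = sideAfter i (not s)

module BipartiteDistances (G : BipartiteGraph) where
  open BipartiteGraph G using (n; adj; irrefl; inY; bip) renaming (sym to adj-sym′)

  private variable
    a b c v w : V G
    i j m : ℕ

  adj? : ∀ u v → Dec (Adj G u v)
  adj? u v = T? (adj u v)

  adj-sym : Adj G v w → Adj G w v
  adj-sym {v} {w} = subst T (adj-sym′ v w)

  adj-irrefl : ¬ Adj G v v
  adj-irrefl {v} = subst T (irrefl v)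

  adj-side : ∀ {s} → Adj G v w → inY v ≡ s → inY w ≡ not s
  adj-side {v} {w} e refl = ¬-not (bip v w e ∘ sym)

  walk-snoc : Walk G a b m → Adj G b c → Walk G a c (suc m)
  walk-snoc here       e = step e here
  walk-snoc (step f p) e = step f (walk-snoc p e)

  walk-reverse : Walk G a b m → Walk G b a m
  walk-reverse here       = here
  walk-reverse (step e p) = walk-snoc (walk-reverse p) (adj-sym e)

  walk-side : Walk G a b m → inY b ≡ sideAfter m (inY a)
  walk-side here                 = refl
  walk-side {m = suc m} (step e p) = trans (walk-side p) (cong (sideAfter m) (adj-side e refl))

  walk? : ∀ a b m → Dec (Walk G a b m)
  walk? a b zero    = map′ (λ { refl → here }) (λ { here → refl }) (a ≟ᶠ b)
  walk? a b (suc m) = map′ (λ (c , e , p) → step e p) (λ { (step e p) → _ , e , p })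
                           (any? λ c → adj? a c ×-dec walk? c b m)

  dist? : ∀ a b i → Dec (Dist G a b i)
  dist? a b i = walk? a b i ×-dec map′ (λ ∄ j j<i p → ∄ (j , j<i , p)) (λ none (j , j<i , p) → none j j<i p)
                                       (¬? (anyUpTo? (walk? a b) i))

  walk⇒dist : Walk G a b m → Σ ℕ λ i → i ≤ m × Dist G a b i
  walk⇒dist {a} {b} {m} = <-rec (λ m → Walk G a b m → Σ ℕ λ i → i ≤ m × Dist G a b i) shorten m
    where
    shorten : ∀ m → (∀ {j} → j < m → Walk G a b j → Σ ℕ λ i → i ≤ j × Dist G a b i) →
              Walk G a b m → Σ ℕ λ i → i ≤ m × Dist G a b i
    shorten m rec p with anyUpTo? (walk? a b) m
    ... | no ∄ = m , ≤-refl , p , λ j j<m q → ∄ (j , j<m , q)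
    ... | yes (j , j<m , q) with rec j<m q
    ...   | i , i≤j , d = i , ≤-trans i≤j (<⇒≤ j<m) , d

  dist≤walk : Dist G a b i → Walk G a b m → i ≤ m
  dist≤walk {m = m} (_ , shortest) p = ≮⇒≥ λ m<i → shortest m m<i p

  dist-unique : Dist G a b i → Dist G a b j → i ≡ j
  dist-unique d d′ = ≤-antisym (dist≤walk d (proj₁ d′)) (dist≤walk d′ (proj₁ d))

  dist-sym : Dist G a b i → Dist G b a i
  dist-sym (p , shortest) = walk-reverse p , λ j j<i q → shortest j j<i (walk-reverse q)

  dist-refl : Dist G a a 0
  dist-refl = here , λ _ ()

  dist-0 : Dist G a b 0 → b ≡ a
  dist-0 (here , _) = refl

  adj⇒dist-1 : Adj G a b → Dist G a b 1
  adj⇒dist-1 e = step e here , λ { zero _ here → adj-irrefl e ; (suc _) (s≤s ()) _ }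

  dist-1⇒adj : Dist G a b 1 → Adj G a b
  dist-1⇒adj (step e here , _) = e

  dist-side : ∀ {s} → inY a ≡ s → Dist G a b i → inY b ≡ sideAfter i s
  dist-side refl (p , _) = walk-side p

  equidistant-nonadjacent : Dist G a v i → Dist G a w i → ¬ Adj G v w
  equidistant-nonadjacent dv dw e = bip _ _ e (trans (dist-side refl dv) (sym (dist-side refl dw)))

  CloserNbr FartherNbr : V G → V G → ℕ → V G → Set
  CloserNbr  a w i u = Adj G w u × Σ ℕ λ j → suc j ≡ i × Dist G a u j
  FartherNbr a w i u = Adj G w u × Dist G a u (suc i)

  closerNbr? : ∀ a w i → Decidable (CloserNbr a w i)
  closerNbr? a w i u = adj? w u ×-dec predDist? i
    where
    predDist? : ∀ i → Dec (Σ ℕ λ j → suc j ≡ i × Dist G a u j)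
    predDist? zero    = no λ ()
    predDist? (suc i) = map′ (λ d → i , refl , d) (λ { (_ , refl , d) → d }) (dist? a u i)

  fartherNbr? : ∀ a w i → Decidable (FartherNbr a w i)
  fartherNbr? a w i u = adj? w u ×-dec dist? a u (suc i)

  closer-or-farther : Dist G a w i → Adj G w v → CloserNbr a w i v ⊎ FartherNbr a w i v
  closer-or-farther {a} {w} {i} {v} dw e with walk⇒dist (walk-snoc (proj₁ dw) e)
  ... | j , j≤1+i , dv with <-cmp j i
  ...   | tri< j<i _ _  = inj₁ (e , j , ≤-antisym j<i (dist≤walk dw (walk-snoc (proj₁ dv) (adj-sym e))) , dv)
  ...   | tri≈ _ refl _ = contradiction e (equidistant-nonadjacent dw dv)
  ...   | tri> _ _ i<j  = inj₂ (e , subst (Dist G a v) (≤-antisym j≤1+i i<j) dv)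

  closer-farther-disjoint : ¬ (CloserNbr a w i v × FartherNbr a w i v)
  closer-farther-disjoint ((_ , j , refl , d) , (_ , d′)) = m≢1+n+m j (dist-unique d d′)

  bAt-from-cAt : ∀ {d c} → Dist G a w i → Valency G w d → CAt G a w i c → BAt G a w i (d ∸ c)
  bAt-from-cAt {a} {w} {i} {d} {c} dw val cAt =
    subst (BAt G a w i) farther≡d∸c (count⇒hasCount (fartherNbr? a w i))
    where
    open ≡-Reasoning
    C? : Decidable (CloserNbr a w i)
    C? = closerNbr? a w i
    B? : Decidable (FartherNbr a w i)
    B? = fartherNbr? a w i
    d≡c+farther : d ≡ c + count B?
    d≡c+farther = begin
      d                                                           ≡⟨ hasCount⇒count (adj? w) val ⟨
      count (adj? w)                                              ≡⟨ count-cong (adj? w) (λ u → C? u ⊎-dec B? u)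
                                                                       (λ _ → closer-or-farther dw) (λ _ → [ proj₁ , proj₁ ]) ⟩
      count (λ u → C? u ⊎-dec B? u)                               ≡⟨ count-⊎ C? B? (λ _ → closer-farther-disjoint) ⟩
      count C? + count B?                                         ≡⟨ cong (_+ count B?) (hasCount⇒count C? cAt) ⟩
      c + count B?                                                ∎
    farther≡d∸c : count B? ≡ d ∸ c
    farther≡d∸c = sym (trans (cong (_∸ c) d≡c+farther) (m+n∸m≡n c _))

  farther-exists : ∀ {d c} → Dist G a w i → Valency G w d → CAt G a w i c → c < d → Σ (V G) λ v → Dist G a v (suc i)
  farther-exists dw val cAt c<d with hasCount-nonempty (bAt-from-cAt dw val cAt) (m<n⇒0<n∸m c<d)
  ... | v , _ , dv = v , dv

  cAt-0 : CAt G a w 0 0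
  cAt-0 = [] , [] , (λ u → (λ ()) , λ { (_ , _ , () , _) }) , refl

  cAt-1 : Dist G a w 1 → CAt G a w 1 1
  cAt-1 {a} dw = a ∷ [] , [] ∷ [] , (λ u → closer , λ { (_ , 0 , refl , d) → here (dist-0 d) }) , refl
    where
    closer : ∀ {u} → u ∈ a ∷ [] → CloserNbr a _ 1 u
    closer (here refl) = adj-sym (dist-1⇒adj dw) , 0 , refl , dist-refl

  dist≤ecc : ∀ {e} → Ecc G a e → Dist G a w i → i ≤ e
  dist≤ecc {e = e} (within , _) d with within _
  ... | j , j≤e , d′ = subst (_≤ e) (dist-unique d′ d) j≤e

  cAt-ecc : ∀ {e d} → Ecc G a e → Dist G a w e → Valency G w d → CAt G a w e d
  cAt-ecc ecc dw = hasCount-cong (λ _ → closer) (λ _ → proj₁)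
    where
    closer : Adj G _ v → CloserNbr _ _ _ v
    closer e with closer-or-farther dw e
    ... | inj₁ c       = c
    ... | inj₂ (_ , d) = contradiction (dist≤ecc ecc d) 1+n≰n

  commonNbrs : V G → V G → ℕ
  commonNbrs a b = count (λ u → adj? a u ×-dec adj? b u)

  closer₂⇒common : CloserNbr a w 2 v → Adj G a v × Adj G w v
  closer₂⇒common (e , 1 , refl , d) = dist-1⇒adj d , e

  common⇒closer₂ : Adj G a v × Adj G w v → CloserNbr a w 2 v
  common⇒closer₂ (ea , ew) = ew , 1 , refl , adj⇒dist-1 ea

  paths₃-double-count : ∀ a b → ∑[ x < n ] (indicator (adj? b x) * commonNbrs a x)
                              ≡ ∑[ u < n ] (indicator (adj? a u) * commonNbrs b u)
  paths₃-double-count a b = begin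
    ∑[ x < n ] (indicator (adj? b x) * commonNbrs a x)  ≡⟨ sum-cong-≗ (expand b a) ⟩
    ∑[ x < n ] ∑[ u < n ] path x u                      ≡⟨ ∑-comm path ⟩
    ∑[ u < n ] ∑[ x < n ] path x u                      ≡⟨ sum-cong-≗ (λ u → trans (sum-cong-≗ (path-reverse u))
                                                                                    (sym (expand a b u))) ⟩
    ∑[ u < n ] (indicator (adj? a u) * commonNbrs b u)  ∎
    where
    open ≡-Reasoning
    [_~_] : V G → V G → ℕ
    [ u ~ v ] = indicator (adj? u v)
    path : V G → V G → ℕ
    path x u = [ b ~ x ] * ([ a ~ u ] * [ x ~ u ])
    expand : ∀ b a x → [ b ~ x ] * commonNbrs a x ≡ ∑[ u < n ] ([ b ~ x ] * ([ a ~ u ] * [ x ~ u ]))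
    expand b a x = trans (*-distribˡ-sum [ b ~ x ] (λ u → indicator (adj? a u ×-dec adj? x u)))
                         (sum-cong-≗ λ u → cong ([ b ~ x ] *_) (indicator-× (adj? a u) (adj? x u)))
    path-reverse : ∀ u x → path x u ≡ [ a ~ u ] * ([ b ~ x ] * [ u ~ x ])
    path-reverse u x = trans (x∙yz≈y∙xz [ b ~ x ] [ a ~ u ] [ x ~ u ])
                             (cong (λ t → [ a ~ u ] * ([ b ~ x ] * t)) (indicator-cong adj-sym adj-sym (adj? x u) (adj? u x)))

  ∑-commonNbrs-over-nbrs : ∀ {c} → (∀ {x} → Dist G a x 2 → commonNbrs a x ≡ c) → Dist G a w 3 →
                           ∑[ x < n ] (indicator (adj? w x) * commonNbrs a x) ≡ c * count (closerNbr? a w 3)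
  ∑-commonNbrs-over-nbrs {a} {w} {c} c₂ dw =
    trans (sum-cong-≗ λ x → term x (adj? w x) (closerNbr? a w 3 x)) (sym (*-distribˡ-sum c (indicator ∘ closerNbr? a w 3)))
    where
    term : ∀ x (e? : Dec (Adj G w x)) (cl? : Dec (CloserNbr a w 3 x)) → indicator e? * commonNbrs a x ≡ c * indicator cl?
    term x (no _)  (no _)                   = sym (*-zeroʳ c)
    term x (no ¬e) (yes (e , _))            = contradiction e ¬e
    term x (yes _) (yes (_ , 2 , refl , d)) = trans (*-identityˡ _) (trans (c₂ d) (sym (*-identityʳ c)))
    term x (yes e) (no ¬cl) with closer-or-farther dw e
    ... | inj₁ cl      = contradiction cl ¬cl
    ... | inj₂ (_ , d) = trans (*-identityˡ _) (trans (count-∅ _ no-common) (sym (*-zeroʳ c)))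
      where
      no-common : ∀ u → ¬ (Adj G a u × Adj G x u)
      no-common u (ea , ex) = contradiction (dist≤walk d (step ea (step (adj-sym ex) here))) λ { (s≤s (s≤s ())) }

  c₂c₃-symmetry : ∀ {cₐ c_w} → (∀ {x} → Dist G a x 2 → commonNbrs a x ≡ cₐ) →
                  (∀ {u} → Dist G w u 2 → commonNbrs w u ≡ c_w) →
                  Dist G a w 3 → cₐ * count (closerNbr? a w 3) ≡ c_w * count (closerNbr? w a 3)
  c₂c₃-symmetry {a} {w} {cₐ} {c_w} c₂ᵃ c₂ʷ dw = begin
    cₐ * count (closerNbr? a w 3)                        ≡⟨ ∑-commonNbrs-over-nbrs c₂ᵃ dw ⟨
    ∑[ x < n ] (indicator (adj? w x) * commonNbrs a x)   ≡⟨ paths₃-double-count a w ⟩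
    ∑[ u < n ] (indicator (adj? a u) * commonNbrs w u)   ≡⟨ ∑-commonNbrs-over-nbrs c₂ʷ (dist-sym dw) ⟩
    c_w * count (closerNbr? w a 3)                       ∎
    where open ≡-Reasoning

module Setting (G : BipartiteGraph) (k l c2Y c3Y c2Z : ℕ)
  (y₀ : Σ (V G) (InY G))
  (valency-Y : ∀ y → InY G y → Valency G y k)
  (valency-Z : ∀ z → InZ G z → Valency G z l)
  (locally-DR : ∀ y → InY G y → LocallyDR4 G y k c2Y c3Y)
  (c₂-Z : ∀ z w → InZ G z → Dist G z w 2 → HasCount G (λ u → Adj G z u × Adj G w u) c2Z)
  (bound : c2Y * c3Y < k * c2Z)
  where

  open BipartiteGraph G using (inY)
  open BipartiteDistances G

  private variable
    i : ℕ
    w y z : V G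

  instance
    k*c2Z-nonZero : NonZero (k * c2Z)
    k*c2Z-nonZero = ≢-nonZero (m<n⇒n≢0 bound)

    c2Z-nonZero : NonZero c2Z
    c2Z-nonZero = m*n≢0⇒n≢0 k

  0<k : 0 < k
  0<k = >-nonZero⁻¹ k {{m*n≢0⇒m≢0 k}}

  beyond-4 : ¬ (5 + i ≤ 4)
  beyond-4 (s≤s (s≤s (s≤s (s≤s ()))))

  valency : Bool → ℕ
  valency true  = k
  valency false = l

  valency-of : ∀ w → Valency G w (valency (inY w))
  valency-of w with inY w in side
  ... | true  = valency-Y w side
  ... | false = valency-Z w side

  valency-at : ∀ {a s} → inY a ≡ s → Dist G a w i → Valency G w (valency (sideAfter i s))
  valency-at {w} aS d = subst (Valency G w ∘ valency) (dist-side aS d) (valency-of w)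

  ecc-Y : InY G y → Ecc G y 4
  ecc-Y {y} yY = proj₁ (locally-DR y yY)

  cY : ℕ → ℕ
  cY 1 = 1
  cY 2 = c2Y
  cY 3 = c3Y
  cY 4 = k
  cY _ = 0

  cAt-Y : ∀ i → InY G y → Dist G y w i → CAt G y w i (cY i)
  cAt-Y {y} {w} i yY d with proj₂ (locally-DR y yY) w
  cAt-Y 0 yY d | _              = cAt-0
  cAt-Y 1 yY d | c₁ , _         = c₁ d
  cAt-Y 2 yY d | _ , c₂ , _     = c₂ d
  cAt-Y 3 yY d | _ , _ , c₃ , _ = c₃ d
  cAt-Y 4 yY d | _ , _ , _ , c₄ = c₄ d
  cAt-Y (suc (suc (suc (suc (suc _))))) yY d | _ = contradiction (dist≤ecc (ecc-Y yY) d) beyond-4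

  Z-has-nbr : InZ G z → Σ (V G) (Adj G z)
  Z-has-nbr {z} zZ with proj₁ (ecc-Y (proj₂ y₀)) z
  ... | zero  , _ , d = contradiction (trans (sym zZ) (dist-side (proj₂ y₀) d)) λ ()
  ... | suc i , _ , (p , _) with walk-reverse p
  ...   | step e _ = _ , e

  within-4-of-Z : InZ G z → ∀ w → Σ ℕ λ i → i ≤ 4 × Dist G z w i
  within-4-of-Z {z} zZ w with inY w in side
  ... | true with proj₁ (ecc-Y side) z
  ...   | i , i≤4 , d = i , i≤4 , dist-sym d
  within-4-of-Z {z} zZ w | false with Z-has-nbr side
  ... | y , e with proj₁ (ecc-Y (adj-side e side)) z
  ...   | i , i≤4 , d with walk⇒dist (walk-snoc (proj₁ (dist-sym d)) (adj-sym e))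
  ...     | j , j≤1+i , d′ = j , ≤-trans j≤1+i (≤∧≢⇒< i≤4 i≢4) , d′
    where
    i≢4 : i ≢ 4
    i≢4 refl = contradiction (trans (sym zZ) (dist-side (adj-side e side) d)) λ ()

  far-3-from-Z : InZ G z → Σ (V G) λ x → Dist G z x 3
  far-3-from-Z zZ with Z-has-nbr zZ
  ... | y , e with proj₂ (ecc-Y (adj-side e zZ))
  ...   | x , d₄ with closer-or-farther (dist-sym d₄) (adj-sym e)
  ...     | inj₁ (_ , 3 , refl , d₃) = x , dist-sym d₃
  ...     | inj₂ (_ , d₅)           = contradiction (dist≤ecc (ecc-Y (dist-side (adj-side e zZ) d₄)) d₅) beyond-4

  commonNbrs-Z : InZ G z → Dist G z w 2 → commonNbrs z w ≡ c2Z
  commonNbrs-Z {z} {w} zZ d = hasCount⇒count _ (c₂-Z z w zZ d)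

  commonNbrs-Y : InY G y → Dist G y w 2 → commonNbrs y w ≡ c2Y
  commonNbrs-Y yY d = hasCount⇒count _ (hasCount-cong (λ _ → closer₂⇒common) (λ _ → common⇒closer₂) (cAt-Y 2 yY d))

  c₂c₃-Z : InZ G z → Dist G z w 3 → c2Z * count (closerNbr? z w 3) ≡ c2Y * c3Y
  c₂c₃-Z {w = w} zZ d = trans (c₂c₃-symmetry (commonNbrs-Z zZ) (commonNbrs-Y wY) d)
                      (cong (c2Y *_) (hasCount⇒count (closerNbr? _ _ 3) (cAt-Y 3 wY (dist-sym d))))
    where
    wY : InY G w
    wY = dist-side zZ d

  y₀-nbr : Σ (V G) (Adj G (proj₁ y₀))
  y₀-nbr = hasCount-nonempty (valency-Y _ (proj₂ y₀)) 0<k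

  z₀ : V G
  z₀ = proj₁ y₀-nbr

  z₀-in-Z : InZ G z₀
  z₀-in-Z = adj-side (proj₂ y₀-nbr) (proj₂ y₀)

  x₀ : V G
  x₀ = proj₁ (far-3-from-Z z₀-in-Z)

  z₀x₀-at-3 : Dist G z₀ x₀ 3
  z₀x₀-at-3 = proj₂ (far-3-from-Z z₀-in-Z)

  -- Any pair at distance 3 would do: by `cAt-Z-3` the count is the same for all of them.
  c3Z : ℕ
  c3Z = count (closerNbr? z₀ x₀ 3)

  c3Z*c2Z : c3Z * c2Z ≡ c2Y * c3Y
  c3Z*c2Z = trans (*-comm c3Z c2Z) (c₂c₃-Z z₀-in-Z z₀x₀-at-3)

  cAt-Z-3 : InZ G z → Dist G z w 3 → CAt G z w 3 c3Z
  cAt-Z-3 {z} {w} zZ d = subst (CAt G z w 3) c₃≡c3Z (count⇒hasCount (closerNbr? z w 3))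
    where
    c₃≡c3Z : count (closerNbr? z w 3) ≡ c3Z
    c₃≡c3Z = *-cancelˡ-≡ _ _ c2Z (trans (c₂c₃-Z zZ d) (sym (c₂c₃-Z z₀-in-Z z₀x₀-at-3)))

  c3Z<k : c3Z < k
  c3Z<k = *-cancelʳ-< c2Z c3Z k (subst (_< k * c2Z) (sym c3Z*c2Z) bound)

  far-4-from-Z : InZ G z → Σ (V G) λ u → Dist G z u 4
  far-4-from-Z zZ with far-3-from-Z zZ
  ... | x , d = farther-exists d (valency-Y x (dist-side zZ d)) (cAt-Z-3 zZ d) c3Z<k

  ecc-Z : InZ G z → Ecc G z 4
  ecc-Z zZ = within-4-of-Z zZ , far-4-from-Z zZ

  cZ : ℕ → ℕ
  cZ 1 = 1
  cZ 2 = c2Z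
  cZ 3 = c3Z
  cZ 4 = l
  cZ _ = 0

  cAt-Z : ∀ i → InZ G z → Dist G z w i → CAt G z w i (cZ i)
  cAt-Z         0 zZ d = cAt-0
  cAt-Z         1 zZ d = cAt-1 d
  cAt-Z {z} {w} 2 zZ d = hasCount-cong (λ _ → common⇒closer₂) (λ _ → closer₂⇒common) (c₂-Z z w zZ d)
  cAt-Z         3 zZ d = cAt-Z-3 zZ d
  cAt-Z         4 zZ d = cAt-ecc (ecc-Z zZ) d (valency-at zZ d)
  cAt-Z (suc (suc (suc (suc (suc _))))) zZ d = contradiction (dist≤ecc (ecc-Z zZ) d) beyond-4

  bY bZ : ℕ → ℕ
  bY i = valency (sideAfter i true)  ∸ cY i
  bZ i = valency (sideAfter i false) ∸ cZ i

  cAt×bAt : ∀ {a s c} → inY a ≡ s → Dist G a w i → CAt G a w i c →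
            CAt G a w i c × BAt G a w i (valency (sideAfter i s) ∸ c)
  cAt×bAt aS d cAt = cAt , bAt-from-cAt d (valency-at aS d) cAt

theorem4p7 : (G : BipartiteGraph) (k l c2Y c3Y c2Z : ℕ) →
    Σ (V G) (InY G) →
    (∀ y → InY G y → Valency G y k) →
    (∀ z → InZ G z → Valency G z l) →
    (∀ y → InY G y → LocallyDR4 G y k c2Y c3Y) →
    (∀ z w → InZ G z → Dist G z w 2 → HasCount G (λ u → Adj G z u × Adj G w u) c2Z) →
    c2Y * c3Y < k * c2Z →
    DBRArray4 G k l c2Y c3Y c2Z
theorem4p7 G k l c2Y c3Y c2Z y₀ valency-Y valency-Z locally-DR c₂-Z bound =
  cY , bY , cZ , bZ ,
  ((λ a w i aY d → cAt×bAt {s = true}  aY d (cAt-Y i aY d)) ,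
   (λ a w i aZ d → cAt×bAt {s = false} aZ d (cAt-Z i aZ d))) ,
  (λ y yY → valency-Y y yY , ecc-Y yY) ,
  (λ z zZ → valency-Z z zZ , ecc-Z zZ) ,
  refl , refl , refl , refl , refl , refl , c3Z*c2Z , refl
  where open Setting G k l c2Y c3Y c2Z y₀ valency-Y valency-Z locally-DR c₂-Z bound
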